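{- Let $A,B\subseteq\mathbb N$ satisfy condition $(*)$: $|A|=|B|=\aleph_0$ and for every $n$ there is $k$ such that for all $a\in A$, $b\in B$ with $a,b>k$ we have $a/b>n$ or $b/a>n$. Then for every infinite set $X\subseteq D_A$, every function $f:X\to D_B$, and every $n>1$, there are distinct $x,y\in X$ such that either $d(f(x),f(y))/d(x,y)>n$ or $d(f(x),f(y))/d(x,y)<1/n$.
   Context: On $2^{\mathbb N}$ (infinite binary sequences) let $\Delta(x,y)$ be the least index at which distinct $x,y$ differ, and let $d(x,y)=2^{ -\Delta(x,y)}$ for $x\neq y$, $d(x,x)=0$. For infinite $A\subseteq\mathbb N$ let $T_A\subseteq 2^{<\mathbb N}$ be the tree defined inductively: it contains the empty sequence, and for $\eta\in T_A$ it contains both $\eta^\frown 0$ and $\eta^\frown 1$ if $|\eta|\in A$, and only $\eta^\frown 0$ if $|\eta|\notin A$. Let $D_A\subseteq 2^{\mathbb N}$ be the set of infinite branches of $T_A$, with the metric $d$ (so the set of positive distances occurring in $D_A$ is $\{2^{ -n}:n\in A\}$). -}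

module Defs where

open import Data.Bool using (Bool; true; false)
open import Data.Nat using (ℕ; zero; suc; _*_; _^_; _<_)
open import Data.List using (List; []; _∷ʳ_; length)
open import Data.Fin using (Fin)
open import Data.Product using (Σ; _×_; ∃; ∃-syntax)
open import Data.Sum using (_⊎_)
open import Relation.Binary.PropositionalEquality using (_≡_; _≢_)

Seq : Set
Seq = ℕ → Bool

Infinite : (ℕ → Set) → Set
Infinite A = ∀ m → ∃[ a ] (m < a × A a)

Star : (ℕ → Set) → (ℕ → Set) → Set
Star A B =
  Infinite A × Infinite B ×
  (∀ n → ∃[ k ] (∀ a b → A a → B b → k < a → k < b → (n * b < a) ⊎ (n * a < b)))

prefix : ℕ → Seq → List Bool
prefix zero    x = []
prefix (suc n) x = prefix n x ∷ʳ x n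

data InTree (A : ℕ → Set) : List Bool → Set where
  root : InTree A []
  ext0 : ∀ {η} → InTree A η → InTree A (η ∷ʳ false)
  ext1 : ∀ {η} → InTree A η → A (length η) → InTree A (η ∷ʳ true)

InD : (ℕ → Set) → Seq → Set
InD A x = ∀ n → InTree A (prefix n x)

-- Δ(x,y) = k : x and y first differ at index k  (so d(x,y) = 2^{-k})
DiffAt : Seq → Seq → ℕ → Set
DiffAt x y k = (∀ i → i < k → x i ≡ y i) × (x k ≢ y k)

-- distinct sequences (constructive: apart)
Apart : Seq → Seq → Set
Apart x y = ∃[ k ] (x k ≢ y k)

InfiniteSet : (Seq → Set) → Set
InfiniteSet X = ∀ m → Σ (Fin m → Seq) λ s →
  (∀ i → X (s i)) × (∀ i j → i ≢ j → Apart (s i) (s j))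

-- Given Δ(x,y) = k:
-- d(u,v)/d(x,y) > n   ⟺  u ≠ v with Δ(u,v) = k' and 2^k > n·2^k'
RatioAbove : ℕ → ℕ → Seq → Seq → Set
RatioAbove n k u v = ∃[ k' ] (DiffAt u v k' × n * 2 ^ k' < 2 ^ k)

-- d(u,v)/d(x,y) < 1/n  ⟺  u = v (distance 0), or Δ(u,v) = k' with n·2^k < 2^k'
RatioBelow : ℕ → ℕ → Seq → Seq → Set
RatioBelow n k u v = ∀ k' → DiffAt u v k' → n * 2 ^ k < 2 ^ k'

-- Choose k for the ratio 2 in condition (*) and put L = k + n + 1. Colouring each x ∈ X by the
-- pair of prefixes (x↾L, f(x)↾L) uses only 4^L colours, so two distinct points x, y of X get the
-- same colour. Then Δ(x,y) = a ≥ L lies in A, and every index b at which f(x), f(y) differ is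
-- ≥ L and lies in B. Condition (*) gives 2b < a or 2a < b, and since a, b > n this forces
-- 2^a > n·2^b or 2^b > n·2^a: the distance ratio is either above n or below 1/n.
module Submission where

open import Defs
open import Data.Nat using (ℕ; zero; suc; _+_; _*_; _^_; _≤_; _<_; _<?_; z≤n; s≤s)
open import Data.Nat.Properties
open import Data.Bool using (Bool; true; false)
import Data.Bool.Properties as Bool
open import Data.Fin using (Fin; combine) renaming (zero to fzero; suc to fsuc)
import Data.Fin.Properties as Fin
open import Data.List using ([]; _∷_; _∷ʳ_; length)
import Data.List.Properties as List
open import Data.Product using (Σ; _×_; _,_; proj₁; proj₂; ∃-syntax)
open import Data.Sum using (_⊎_; inj₁; inj₂)
import Data.Sum as Sum
open import Data.Empty using (⊥-elim)
open import Relation.Nullary using (yes; no)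
open import Relation.Binary.PropositionalEquality

Agree : ℕ → Seq → Seq → Set
Agree k x y = ∀ i → i < k → x i ≡ y i

agree⊎diffAtBelow : ∀ x y k → Agree k x y ⊎ ∃[ a ] (a < k × DiffAt x y a)
agree⊎diffAtBelow x y zero = inj₁ (λ _ ())
agree⊎diffAtBelow x y (suc k) with agree⊎diffAtBelow x y k
... | inj₂ (a , a<k , d) = inj₂ (a , m<n⇒m<1+n a<k , d)
... | inj₁ agree with x k Bool.≟ y k
...   | no xk≢yk = inj₂ (k , ≤-refl , agree , xk≢yk)
...   | yes xk≡yk = inj₁ agreeSuc
  where
  agreeSuc : Agree (suc k) x y
  agreeSuc i i<1+k with m<1+n⇒m<n∨m≡n i<1+k
  ... | inj₁ i<k = agree i i<k
  ... | inj₂ refl = xk≡yk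

apart⇒diffAt : ∀ {x y} → Apart x y → ∃[ a ] DiffAt x y a
apart⇒diffAt {x} {y} (k , xk≢yk) with agree⊎diffAtBelow x y (suc k)
... | inj₁ agree = ⊥-elim (xk≢yk (agree k ≤-refl))
... | inj₂ (a , _ , d) = a , d

agree⇒≤diffAt : ∀ {k x y a} → Agree k x y → DiffAt x y a → k ≤ a
agree⇒≤diffAt {k} {a = a} agree (_ , xa≢ya) with a <? k
... | yes a<k = ⊥-elim (xa≢ya (agree a a<k))
... | no a≮k = ≮⇒≥ a≮k

InTree-∷ʳtrue : ∀ {A η} → InTree A (η ∷ʳ true) → A (length η)
InTree-∷ʳtrue {A} t = go t refl
  where
  go : ∀ {ζ η} → InTree A ζ → ζ ≡ η ∷ʳ true → A (length η)
  go {η = []}    root ()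
  go {η = _ ∷ _} root ()
  go {η = η} (ext0 {η′} _) e with () ← List.∷ʳ-injectiveʳ η′ η e
  go {η = η} (ext1 {η′} _ a) e = subst (λ ζ → A (length ζ)) (List.∷ʳ-injectiveˡ η′ η e) a

length-prefix : ∀ n x → length (prefix n x) ≡ n
length-prefix zero x = refl
length-prefix (suc n) x = begin
  length (prefix n x ∷ʳ x n)  ≡⟨ List.length-++ (prefix n x) ⟩
  length (prefix n x) + 1     ≡⟨ +-comm _ 1 ⟩
  suc (length (prefix n x))   ≡⟨ cong suc (length-prefix n x) ⟩
  suc n                       ∎
  where open ≡-Reasoning

InD-true⇒∈ : ∀ {A x a} → InD A x → x a ≡ true → A a
InD-true⇒∈ {A} {x} {a} x∈D xa≡true = subst A (length-prefix a x)
  (InTree-∷ʳtrue (subst (λ b → InTree A (prefix a x ∷ʳ b)) xa≡true (x∈D (suc a))))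

-- Two branches of T_A can only split at a level in A, where one of them takes the bit 1.
diffAt⇒∈ : ∀ {A x y a} → InD A x → InD A y → DiffAt x y a → A a
diffAt⇒∈ {x = x} {y} {a} x∈D y∈D (_ , xa≢ya) with x a in ex | y a in ey
... | true  | _     = InD-true⇒∈ x∈D ex
... | false | true  = InD-true⇒∈ y∈D ey
... | false | false = ⊥-elim (xa≢ya refl)

bitCode : Bool → Fin 2
bitCode false = fzero
bitCode true  = fsuc fzero

bitCode-injective : ∀ b c → bitCode b ≡ bitCode c → b ≡ c
bitCode-injective false false _ = refl
bitCode-injective true  true  _ = refl

prefixCode : (L : ℕ) → Seq → Fin (2 ^ L)
prefixCode zero    x = fzero
prefixCode (suc L) x = combine (bitCode (x 0)) (prefixCode L (λ t → x (suc t)))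

prefixCode-injective : ∀ L x y → prefixCode L x ≡ prefixCode L y → Agree L x y
prefixCode-injective (suc L) x y e i i<1+L
  with Fin.combine-injective (bitCode (x 0)) (prefixCode L (λ t → x (suc t)))
                             (bitCode (y 0)) (prefixCode L (λ t → y (suc t))) e
prefixCode-injective (suc L) x y e zero    _         | e₀ , _ = bitCode-injective _ _ e₀
prefixCode-injective (suc L) x y e (suc i) (s≤s i<L) | _ , eₛ =
  prefixCode-injective L (λ t → x (suc t)) (λ t → y (suc t)) eₛ i i<L

pigeonhole-InfiniteSet : ∀ {X m} → InfiniteSet X → (c : Σ Seq X → Fin m) →
  ∃[ x ] ∃[ y ] Σ (X x) λ px → Σ (X y) λ py → Apart x y × c (x , px) ≡ c (y , py)
pigeonhole-InfiniteSet {m = m} infX c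
  with s , s∈X , s-apart ← infX (suc m)
  with i , j , i<j , ci≡cj ← Fin.pigeonhole (n<1+n m) (λ i → c (s i , s∈X i))
  = s i , s j , s∈X i , s∈X j , s-apart i j (Fin.<⇒≢ i<j) , ci≡cj

agreeingPair : ∀ {X} → InfiniteSet X → (f : Σ Seq X → Seq) → ∀ L →
  ∃[ x ] ∃[ y ] Σ (X x) λ px → Σ (X y) λ py →
    Apart x y × Agree L x y × Agree L (f (x , px)) (f (y , py))
agreeingPair infX f L
  with x , y , px , py , x#y , sameCodes ←
         pigeonhole-InfiniteSet infX (λ p → combine (prefixCode L (proj₁ p)) (prefixCode L (f p)))
  with xCodes , fCodes ← Fin.combine-injective _ _ _ _ sameCodes
  = x , y , px , py , x#y , prefixCode-injective L _ _ xCodes , prefixCode-injective L _ _ fCodes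

n<2^n : ∀ n → n < 2 ^ n
n<2^n zero    = s≤s z≤n
n<2^n (suc n) = begin-strict
  suc n           ≡⟨ +-comm 1 n ⟩
  n + 1           <⟨ +-mono-<-≤ (n<2^n n) (m^n>0 2 n) ⟩
  2 ^ n + 2 ^ n   ≡⟨ cong (2 ^ n +_) (sym (+-identityʳ (2 ^ n))) ⟩
  2 ^ suc n       ∎
  where open ≤-Reasoning

*2^<2^ : ∀ n b c → b + n < c → n * 2 ^ b < 2 ^ c
*2^<2^ n b c b+n<c = begin-strict
  n * 2 ^ b      <⟨ *-monoˡ-< (2 ^ b) {{m^n≢0 2 b}} (n<2^n n) ⟩
  2 ^ n * 2 ^ b  ≡⟨ sym (^-distribˡ-+-* 2 n b) ⟩
  2 ^ (n + b)    ≤⟨ ^-monoʳ-≤ 2 (≤-trans (≤-reflexive (+-comm n b)) (<⇒≤ b+n<c)) ⟩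
  2 ^ c          ∎
  where open ≤-Reasoning

2*<⇒+< : ∀ {n a c} → n < a → 2 * a < c → a + n < c
2*<⇒+< {n} {a} {c} n<a 2a<c =
  ≤-<-trans (+-monoʳ-≤ a (<⇒≤ n<a)) (subst (λ m → a + m < c) (+-identityʳ a) 2a<c)

ratioDichotomy : ∀ n a u v → (∀ b → DiffAt u v b → b + n < a ⊎ a + n < b) →
  RatioAbove n a u v ⊎ RatioBelow n a u v
ratioDichotomy n a u v gap with agree⊎diffAtBelow u v a
... | inj₂ (b , b<a , db) with gap b db
...   | inj₁ b+n<a = inj₁ (b , db , *2^<2^ n b a b+n<a)
...   | inj₂ a+n<b = ⊥-elim (<-asym b<a (m+n≤o⇒m≤o (suc a) a+n<b))
ratioDichotomy n a u v gap | inj₁ agree = inj₂ below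
  where
  below : RatioBelow n a u v
  below b db with gap b db
  ... | inj₂ a+n<b = *2^<2^ n a b a+n<b
  ... | inj₁ b+n<a = ⊥-elim (<⇒≱ (m+n≤o⇒m≤o (suc b) b+n<a) (agree⇒≤diffAt agree db))

mainTheorem11 : (A B : ℕ → Set) → Star A B →
    (X : Seq → Set) → (∀ x → X x → InD A x) → InfiniteSet X →
    (f : Σ Seq X → Seq) → (∀ p → InD B (f p)) →
    (n : ℕ) → 1 < n →
    ∃[ x ] ∃[ y ] Σ (X x) λ px → Σ (X y) λ py → ∃[ k ] (DiffAt x y k ×
    (RatioAbove n k (f (x , px)) (f (y , py)) ⊎ RatioBelow n k (f (x , px)) (f (y , py))))
mainTheorem11 A B (_ , _ , star) X X⊆D infX f fB n _
  with K , separated ← star 2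
  with x , y , px , py , x#y , xAgree , fAgree ← agreeingPair infX f (suc (K + n))
  with a , dxy ← apart⇒diffAt x#y
  = x , y , px , py , a , dxy , ratioDichotomy n a (f (x , px)) (f (y , py)) gap
  where
  above : ∀ {b} → suc (K + n) ≤ b → K < b × n < b
  above large = ≤-trans (s≤s (m≤m+n K n)) large , ≤-trans (s≤s (m≤n+m n K)) large
  a-large : suc (K + n) ≤ a
  a-large = agree⇒≤diffAt xAgree dxy
  gap : ∀ b → DiffAt (f (x , px)) (f (y , py)) b → b + n < a ⊎ a + n < b
  gap b db = Sum.map (2*<⇒+< (proj₂ (above b-large))) (2*<⇒+< (proj₂ (above a-large)))
    (separated a b (diffAt⇒∈ (X⊆D x px) (X⊆D y py) dxy) (diffAt⇒∈ (fB _) (fB _) db)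
                   (proj₁ (above a-large)) (proj₁ (above b-large)))
    where
    b-large : suc (K + n) ≤ b
    b-large = agree⇒≤diffAt fAgree db
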